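{- For $n\ge 1$ and integers $k,\ell$, let $f_n(k,\ell)$ be the number of $e\in\mathbf{I}_n(0012)$ with $\textsc{srpt}(e)=k$ and $\textsc{last}(e)=\ell$. Then $f_n(k,\ell)\ne 0$ if and only if $(k,\ell)\in\{(k,\ell)\in\mathbb{N}^2: 0\le k\le\ell\le n-1\}\setminus\{(n-2,n-1)\}$.
   Context: An inversion sequence of length $n$ is a sequence $e=e_1\cdots e_n$ of integers with $0\le e_i\le i-1$. The reduction of a word replaces each occurrence of the $k$-th smallest distinct entry by $k-1$; $e$ contains a pattern $p$ if some subsequence (entries at increasing positions) has reduction $p$, and avoids $p$ otherwise. $\mathbf{I}_n(0012)$ is the set of inversion sequences of length $n$ avoiding $0012$. For $e\in\mathbf{I}_n(0012)$, $\mathcal{R}(e)$ is the set of values appearing at least twice in $e$, $\textsc{srpt}(e)=\min\mathcal{R}(e)$ with the convention $\textsc{srpt}(01\cdots(n-1))=n-1$, and $\textsc{last}(e)=e_n$. -}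

module Defs where

open import Data.Bool using (Bool; true; false; _∧_; not)
open import Data.Nat as ℕ using (ℕ; zero; suc; _<ᵇ_; _≡ᵇ_; _∸_; _⊔_; _⊓_)
open import Data.Integer as ℤ using (ℤ; +_)
open import Data.List using (List; []; _∷_; _++_; [_]; map; concatMap; filter; length; upTo; foldr; deduplicate)
open import Data.Bool.ListAction using (any)
import Data.Bool as B
open import Relation.Nullary.Decidable using (⌊_⌋)
open import Relation.Binary.PropositionalEquality using (_≡_)

invSeqs : ℕ → List (List ℕ)
invSeqs zero    = [] ∷ []
invSeqs (suc n) = concatMap (λ e → map (λ x → e ++ [ x ]) (upTo (suc n))) (invSeqs n)

subseqs : List ℕ → List (List ℕ)
subseqs []       = [] ∷ []
subseqs (x ∷ xs) = map (x ∷_) (subseqs xs) ++ subseqs xs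

eqList : List ℕ → List ℕ → Bool
eqList []       []       = true
eqList (x ∷ xs) (y ∷ ys) = (x ≡ᵇ y) ∧ eqList xs ys
eqList _        _        = false

-- Reduction: each occurrence of the k-th smallest distinct entry becomes k-1,
-- i.e. x ↦ number of distinct entries of w strictly smaller than x.
reduce : List ℕ → List ℕ
reduce w = map (λ x → length (filter (λ y → y ℕ.<? x) (deduplicate ℕ._≟_ w))) w

containsᵇ : List ℕ → List ℕ → Bool
containsᵇ e p = any (λ s → eqList (reduce s) p) (subseqs e)

avoidsᵇ : List ℕ → List ℕ → Bool
avoidsᵇ e p = not (containsᵇ e p)

p0012 : List ℕ
p0012 = 0 ∷ 0 ∷ 1 ∷ 2 ∷ []

occ : ℕ → List ℕ → ℕ
occ x e = length (filter (λ y → y ℕ.≟ x) e)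

-- 𝓡(e): values appearing at least twice in e (listed with repetitions; irrelevant for min).
repeated : List ℕ → List ℕ
repeated e = filter (λ x → 2 ℕ.≤? occ x e) e

-- srpt(e) = min 𝓡(e); if 𝓡(e) is empty (which for inversion sequences happens
-- exactly for e = 01⋯(n-1)) the convention gives n-1.
srpt : List ℕ → ℕ
srpt e with repeated e
... | []     = length e ∸ 1
... | x ∷ xs = foldr _⊓_ x xs

-- last(e) = eₙ (only used for n ≥ 1).
lastEntry : List ℕ → ℕ
lastEntry []           = 0
lastEntry (x ∷ [])     = x
lastEntry (_ ∷ y ∷ ys) = lastEntry (y ∷ ys)

f : ℕ → ℤ → ℤ → ℕ
f n k ℓ = length (filter (λ e → (⌊ ℤ._≟_ (+ srpt e) k ⌋ ∧ ⌊ ℤ._≟_ (+ lastEntry e) ℓ ⌋) B.≟ true)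
                   (filter (λ e → avoidsᵇ e p0012 B.≟ true) (invSeqs n)))

-- Necessity holds for every inversion sequence e of length m + 1, avoiding 0012 or not.
-- The prefix e₁⋯eₘ is either 01⋯(m-1), or it repeats some value r ≤ m - 2 while
-- containing every value 0, …, r.  In the latter case srpt(e) ≤ r ≤ m - 2, which rules
-- out the corner (m - 1, m), and srpt(e) ≤ eₘ₊₁, since eₘ₊₁ ≤ r makes the last entry
-- itself a repeat.  Conversely the admissible pairs (k, ℓ) are realised by 01⋯m, by
-- 01⋯(m-1)k and by 01⋯(m-2)kℓ.  These avoid 0012: an occurrence of 0012 starts with two
-- equal entries, which cannot both lie in a strictly increasing prefix followed by at
-- most two further entries.

module Submission where

open import Defs
open import Data.Nat using (ℕ; _≤_)
open import Data.Integer using (ℤ; +_; _-_)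
open import Data.Product using (_×_)
open import Relation.Nullary using (¬_)
open import Relation.Binary.PropositionalEquality using (_≡_; _≢_)
open import Function.Bundles using (_⇔_)

open import Data.Bool using (true; T; _∧_)
import Data.Bool as Bool
open import Data.Bool.Properties using (T-∧; ¬-not)
open import Data.Integer as ℤ using (+≤+)
open import Data.List
  using (List; []; _∷_; _++_; [_]; _∷ʳ_; filter; length; upTo; foldr; map; deduplicate)
open import Data.List.Membership.Propositional using (_∈_; _∉_; find)
open import Data.List.Membership.Propositional.Properties
  using (∈-filter⁺; ∈-filter⁻; ∈-++⁺ˡ; ∈-++⁺ʳ; ∈-++⁻; ∈-map⁺; ∈-map⁻; ∈-upTo⁺; ∈-upTo⁻;
         ∈-concatMap⁺; ∈-concatMap⁻; ∈-deduplicate⁺; foldr-selective)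
open import Data.List.Properties
  using (filter-++; filter-accept; filter-reject; length-++; length-upTo; upTo-∷ʳ; ++-assoc;
         ∷-injectiveˡ; ∷-injectiveʳ; foldr-preservesᵒ)
open import Data.List.Relation.Unary.All as All using (All; []; _∷_)
open import Data.List.Relation.Unary.AllPairs using (AllPairs; []; _∷_)
import Data.List.Relation.Unary.AllPairs.Properties as AllPairs
open import Data.List.Relation.Unary.Any as Any using (here; there)
open import Data.List.Relation.Unary.Any.Properties using (any⁻)
open import Data.Nat using (zero; suc; _<_; _⊓_; _+_; _≟_; _<?_; _≤?_; _∸_; z≤n; s≤s)
open import Data.Nat.Properties
open import Data.Product using (_,_; ∃; ∃₂; ∃-syntax; proj₁; proj₂)
open import Data.Sum using (_⊎_; inj₁; inj₂; [_,_]′)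
open import Data.Unit using (tt)
open import Function using (_∘_)
open import Function.Bundles using (Equivalence; mk⇔)
open import Relation.Nullary using (Dec; yes; no; contradiction)
open import Relation.Binary.Definitions using (tri<; tri≈; tri>)
open import Relation.Nullary.Decidable using (⌊_⌋; decidable-stable)
open import Relation.Binary.PropositionalEquality
  using (refl; sym; trans; cong; cong₂; subst; module ≡-Reasoning)
open import Relation.Unary using (Decidable)

open Equivalence using (to; from)

⌊⌋∧⌊⌋≡true⇔ : ∀ {A B : Set} (a? : Dec A) (b? : Dec B) → (⌊ a? ⌋ ∧ ⌊ b? ⌋) ≡ true ⇔ (A × B)
⌊⌋∧⌊⌋≡true⇔ (yes a) (yes b) = mk⇔ (λ _ → a , b) (λ _ → refl)
⌊⌋∧⌊⌋≡true⇔ (yes _) (no ¬b) = mk⇔ (λ ()) (λ (_ , b) → contradiction b ¬b)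
⌊⌋∧⌊⌋≡true⇔ (no ¬a) _       = mk⇔ (λ ()) (λ (a , _) → contradiction a ¬a)

module _ {A : Set} where

  length-filter≢0⇔∃ : ∀ {P : A → Set} (P? : Decidable P) xs →
    length (filter P? xs) ≢ 0 ⇔ (∃[ x ] (x ∈ xs × P x))
  length-filter≢0⇔∃ {P} P? xs = mk⇔ nonempty⇒∃ ∃⇒nonempty
    where
    nonempty⇒∃ : length (filter P? xs) ≢ 0 → ∃[ x ] (x ∈ xs × P x)
    nonempty⇒∃ ≢0 with filter P? xs in eq
    ... | []    = contradiction refl ≢0
    ... | x ∷ _ = x , ∈-filter⁻ P? (subst (x ∈_) (sym eq) (here refl))
    ∃⇒nonempty : ∃[ x ] (x ∈ xs × P x) → length (filter P? xs) ≢ 0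
    ∃⇒nonempty (x , x∈xs , px) with filter P? xs | ∈-filter⁺ P? x∈xs px
    ... | _ ∷ _ | _ = λ ()

  length-filter-filter≢0⇔∃ : ∀ {P Q : A → Set} (P? : Decidable P) (Q? : Decidable Q) xs →
    length (filter Q? (filter P? xs)) ≢ 0 ⇔ (∃[ x ] (x ∈ xs × P x × Q x))
  length-filter-filter≢0⇔∃ P? Q? xs = mk⇔
    (λ ≢0 → let x , x∈ , qx = to (length-filter≢0⇔∃ Q? _) ≢0
                x∈xs , px = ∈-filter⁻ P? x∈
            in x , x∈xs , px , qx)
    (λ (x , x∈xs , px , qx) → from (length-filter≢0⇔∃ Q? _) (x , ∈-filter⁺ P? x∈xs px , qx))

Realises : ℕ → ℤ → ℤ → List ℕ → Set
Realises n k ℓ e = e ∈ invSeqs n × avoidsᵇ e p0012 ≡ true × + srpt e ≡ k × + lastEntry e ≡ ℓ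

f≢0⇔realised : ∀ n k ℓ → f n k ℓ ≢ 0 ⇔ ∃ (Realises n k ℓ)
f≢0⇔realised n k ℓ = mk⇔
  (λ ≢0 → let e , e∈ , av , q = to counted ≢0 in e , e∈ , av , to (statistics e) q)
  (λ (e , e∈ , av , eqs) → from counted (e , e∈ , av , from (statistics e) eqs))
  where
  statistics : ∀ e → (⌊ + srpt e ℤ.≟ k ⌋ ∧ ⌊ + lastEntry e ℤ.≟ ℓ ⌋) ≡ true ⇔
                     (+ srpt e ≡ k × + lastEntry e ≡ ℓ)
  statistics e = ⌊⌋∧⌊⌋≡true⇔ (+ srpt e ℤ.≟ k) (+ lastEntry e ℤ.≟ ℓ)
  counted : f n k ℓ ≢ 0 ⇔
    (∃[ e ] (e ∈ invSeqs n × avoidsᵇ e p0012 ≡ true ×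
             (⌊ + srpt e ℤ.≟ k ⌋ ∧ ⌊ + lastEntry e ℤ.≟ ℓ ⌋) ≡ true))
  counted = length-filter-filter≢0⇔∃ _ _ (invSeqs n)

occ-++ : ∀ x xs ys → occ x (xs ++ ys) ≡ occ x xs + occ x ys
occ-++ x xs ys = trans (cong length (filter-++ (_≟ x) xs ys)) (length-++ (filter (_≟ x) xs))

occ-mono-++ : ∀ x xs ys → occ x xs ≤ occ x (xs ++ ys)
occ-mono-++ x xs ys = subst (occ x xs ≤_) (sym (occ-++ x xs ys)) (m≤m+n _ _)

occ≢0⇔∈ : ∀ {x e} → occ x e ≢ 0 ⇔ x ∈ e
occ≢0⇔∈ {x} {e} = mk⇔
  (λ ≢0 → let _ , y∈e , y≡x = to (length-filter≢0⇔∃ (_≟ x) e) ≢0 in subst (_∈ e) y≡x y∈e)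
  (λ x∈e → from (length-filter≢0⇔∃ (_≟ x) e) (x , x∈e , refl))

∉⇒occ≡0 : ∀ {x e} → x ∉ e → occ x e ≡ 0
∉⇒occ≡0 x∉e = decidable-stable (_ ≟ 0) (x∉e ∘ to occ≢0⇔∈)

∈-both⇒occ≥2 : ∀ {x} xs ys → x ∈ xs → x ∈ ys → 2 ≤ occ x (xs ++ ys)
∈-both⇒occ≥2 {x} xs ys x∈xs x∈ys = subst (2 ≤_) (sym (occ-++ x xs ys))
  (+-mono-≤ (n≢0⇒n>0 (from occ≢0⇔∈ x∈xs)) (n≢0⇒n>0 (from occ≢0⇔∈ x∈ys)))

occ-increasing≤1 : ∀ {x xs} → AllPairs _<_ xs → occ x xs ≤ 1
occ-increasing≤1 [] = z≤n
occ-increasing≤1 {x} {y ∷ ys} (y<ys ∷ ys↑) with y ≟ x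
... | yes refl rewrite filter-accept (_≟ x) {xs = ys} refl =
  ≤-reflexive (cong suc (∉⇒occ≡0 λ y∈ys → <-irrefl refl (All.lookup y<ys y∈ys)))
... | no y≢x rewrite filter-reject (_≟ x) {xs = ys} y≢x = occ-increasing≤1 ys↑

repeated-in-suffix : ∀ {y xs ys} → AllPairs _<_ xs → 2 ≤ occ y (xs ++ ys) → y ∈ ys
repeated-in-suffix {y} {xs} {ys} xs↑ occ≥2 = to occ≢0⇔∈ λ occ≡0 → <-irrefl refl (begin
  2                         ≤⟨ occ≥2 ⟩
  occ y (xs ++ ys)          ≡⟨ occ-++ y xs ys ⟩
  occ y xs + occ y ys       ≡⟨ cong (λ q → occ y xs + q) occ≡0 ⟩
  occ y xs + 0              ≡⟨ +-identityʳ _ ⟩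
  occ y xs                  ≤⟨ occ-increasing≤1 xs↑ ⟩
  1                         ∎)
  where open ≤-Reasoning

∈-repeated⇔ : ∀ {x} e → x ∈ repeated e ⇔ 2 ≤ occ x e
∈-repeated⇔ e = mk⇔
  (proj₂ ∘ ∈-filter⁻ (λ y → 2 ≤? occ y e) {xs = e})
  (λ occ≥2 → ∈-filter⁺ (λ y → 2 ≤? occ y e)
               (to (occ≢0⇔∈ {e = e}) (n>0⇒n≢0 (≤-trans (s≤s z≤n) occ≥2))) occ≥2)

foldr⊓-≤ : ∀ {x y ys} → x ∈ y ∷ ys → foldr _⊓_ y ys ≤ x
foldr⊓-≤ {x} {y} {ys} x∈ = foldr-preservesᵒ (λ a b → [ m≤n⇒m⊓o≤n b , m≤n⇒o⊓m≤n a ]′) y ys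
  (Any.toSum (Any.map (≤-reflexive ∘ sym) x∈))

foldr⊓-∈ : ∀ y ys → foldr _⊓_ y ys ∈ y ∷ ys
foldr⊓-∈ y ys = [ here , there ]′ (foldr-selective ⊓-sel y ys)

srpt≤repeat : ∀ {x} e → 2 ≤ occ x e → srpt e ≤ x
srpt≤repeat e occ≥2 with repeated e | from (∈-repeated⇔ e) occ≥2
... | []     | ()
... | y ∷ ys | x∈ = foldr⊓-≤ x∈

srpt-cases : ∀ e → srpt e ∈ repeated e ⊎ (repeated e ≡ [] × srpt e ≡ length e ∸ 1)
srpt-cases e with repeated e
... | []     = inj₂ (refl , refl)
... | y ∷ ys = inj₁ (foldr⊓-∈ y ys)

srpt≡least-repeat : ∀ {x} e → 2 ≤ occ x e → (∀ {y} → 2 ≤ occ y e → x ≤ y) → srpt e ≡ x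
srpt≡least-repeat e occ≥2 minimal with srpt-cases e
... | inj₁ srpt∈ = ≤-antisym (srpt≤repeat e occ≥2) (minimal (to (∈-repeated⇔ e) srpt∈))
... | inj₂ (none , _) with () ← subst (_ ∈_) none (from (∈-repeated⇔ e) occ≥2)

srpt-noRepeat : ∀ e → (∀ y → occ y e ≤ 1) → srpt e ≡ length e ∸ 1
srpt-noRepeat e occ≤1 with srpt-cases e
... | inj₁ srpt∈      = contradiction (occ≤1 _) (<⇒≱ (to (∈-repeated⇔ e) srpt∈))
... | inj₂ (_ , srpt≡) = srpt≡

lastEntry-++ : ∀ xs {y ys} → lastEntry (xs ++ y ∷ ys) ≡ lastEntry (y ∷ ys)
lastEntry-++ []           = refl
lastEntry-++ (_ ∷ [])     = refl
lastEntry-++ (_ ∷ x ∷ xs) = lastEntry-++ (x ∷ xs)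

∷ʳ∈invSeqs : ∀ {n e x} → e ∈ invSeqs n → x ≤ n → e ∷ʳ x ∈ invSeqs (suc n)
∷ʳ∈invSeqs {n} {e} e∈ x≤n = ∈-concatMap⁺ (λ e → map (e ∷ʳ_) (upTo (suc n)))
  (Any.map (λ { refl → ∈-map⁺ (_ ∷ʳ_) (∈-upTo⁺ (s≤s x≤n)) }) e∈)

∈invSeqs-suc⁻ : ∀ {n e} → e ∈ invSeqs (suc n) →
  ∃₂ λ e′ x → e′ ∈ invSeqs n × x ≤ n × e ≡ e′ ∷ʳ x
∈invSeqs-suc⁻ {n} e∈ with find (∈-concatMap⁻ (λ e → map (e ∷ʳ_) (upTo (suc n))) {xs = invSeqs n} e∈)
... | e′ , e′∈ , e∈map with ∈-map⁻ (e′ ∷ʳ_) e∈map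
...   | x , x∈ , refl = e′ , x , e′∈ , ≤-pred (∈-upTo⁻ x∈) , refl

upTo∈invSeqs : ∀ n → upTo n ∈ invSeqs n
upTo∈invSeqs zero    = here refl
upTo∈invSeqs (suc n) = subst (_∈ invSeqs (suc n)) (upTo-∷ʳ n) (∷ʳ∈invSeqs (upTo∈invSeqs n) ≤-refl)

upTo-increasing : ∀ n → AllPairs _<_ (upTo n)
upTo-increasing n = AllPairs.applyUpTo⁺₁ (λ i → i) n (λ i<j _ → i<j)

srpt-upTo : ∀ n → srpt (upTo n ∷ʳ n) ≡ n
srpt-upTo n = begin
  srpt (upTo n ∷ʳ n)            ≡⟨ cong srpt (upTo-∷ʳ n) ⟩
  srpt (upTo (suc n))           ≡⟨ srpt-noRepeat (upTo (suc n))
                                     (λ y → occ-increasing≤1 {y} (upTo-increasing (suc n))) ⟩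
  length (upTo (suc n)) ∸ 1     ≡⟨ cong (_∸ 1) (length-upTo (suc n)) ⟩
  n                             ∎
  where open ≡-Reasoning

srpt-∷ʳ≤ : ∀ {x e} → x ∈ e → srpt (e ∷ʳ x) ≤ x
srpt-∷ʳ≤ {x} {e} x∈e = srpt≤repeat (e ∷ʳ x) (∈-both⇒occ≥2 e [ x ] x∈e (here refl))

record SmallRepeat (m : ℕ) (e : List ℕ) : Set where
  field
    value   : ℕ
    repeats : 2 ≤ occ value e
    covers  : ∀ {v} → v ≤ value → v ∈ e
    small   : 2 + value ≤ m

invSeq-cases : ∀ {m e} → e ∈ invSeqs m → e ≡ upTo m ⊎ SmallRepeat m e
invSeq-cases {zero} (here refl) = inj₁ refl
invSeq-cases {suc m} e∈ with ∈invSeqs-suc⁻ {m} e∈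
... | e′ , x , e′∈ , x≤m , refl with invSeq-cases {m} e′∈ | m≤n⇒m<n∨m≡n x≤m
...   | inj₁ refl | inj₂ refl = inj₁ (upTo-∷ʳ x)
...   | inj₁ refl | inj₁ x<m  = inj₂ record
  { value   = x
  ; repeats = ∈-both⇒occ≥2 (upTo m) [ x ] (∈-upTo⁺ x<m) (here refl)
  ; covers  = λ v≤x → ∈-++⁺ˡ (∈-upTo⁺ (≤-<-trans v≤x x<m))
  ; small   = s≤s x<m
  }
...   | inj₂ r | _ = inj₂ record
  { value   = value
  ; repeats = ≤-trans repeats (occ-mono-++ value e′ [ x ])
  ; covers  = ∈-++⁺ˡ ∘ covers
  ; small   = m≤n⇒m≤1+n small
  }
  where open SmallRepeat r

-- The region of the theorem for n = m + 1, over ℕ; the excluded corner is (m - 1, m).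
record Admissible (m k ℓ : ℕ) : Set where
  constructor admissible
  field
    k≤ℓ        : k ≤ ℓ
    ℓ≤m        : ℓ ≤ m
    not-corner : ¬ (suc k ≡ m × ℓ ≡ m)

smallRepeat-∷ʳ-admissible : ∀ {m e x} → SmallRepeat m e → x ≤ m → Admissible m (srpt (e ∷ʳ x)) x
smallRepeat-∷ʳ-admissible {e = e} {x} r x≤m = admissible srpt≤x x≤m
  (λ (corner , _) → <⇒≢ (≤-trans (s≤s (s≤s srpt≤value)) small) corner)
  where
  open SmallRepeat r
  srpt≤value : srpt (e ∷ʳ x) ≤ value
  srpt≤value = srpt≤repeat (e ∷ʳ x) (≤-trans repeats (occ-mono-++ value e [ x ]))
  srpt≤x : srpt (e ∷ʳ x) ≤ x
  srpt≤x with x ≤? value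
  ... | yes x≤value = srpt-∷ʳ≤ (covers x≤value)
  ... | no  x≰value = ≤-trans srpt≤value (<⇒≤ (≰⇒> x≰value))

admissible-srpt-last : ∀ {m e} → e ∈ invSeqs (suc m) → Admissible m (srpt e) (lastEntry e)
admissible-srpt-last {m} e∈ with ∈invSeqs-suc⁻ {m} e∈
... | e′ , x , e′∈ , x≤m , refl rewrite lastEntry-++ e′ {x} {[]}
  with invSeq-cases {m} e′∈ | m≤n⇒m<n∨m≡n x≤m
...   | inj₁ refl | inj₂ refl rewrite srpt-upTo x = admissible ≤-refl ≤-refl (1+n≢n ∘ proj₁)
...   | inj₁ refl | inj₁ x<m  = admissible (srpt-∷ʳ≤ (∈-upTo⁺ x<m)) x≤m (<⇒≢ x<m ∘ proj₂)
...   | inj₂ r    | _         = smallRepeat-∷ʳ-admissible r x≤m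

∈-subseqs-∷⁻ : ∀ x xs {s} → s ∈ subseqs (x ∷ xs) →
  (∃[ s′ ] (s′ ∈ subseqs xs × s ≡ x ∷ s′)) ⊎ s ∈ subseqs xs
∈-subseqs-∷⁻ x xs s∈ with ∈-++⁻ (map (x ∷_) (subseqs xs)) s∈
... | inj₁ s∈map = inj₁ (∈-map⁻ (x ∷_) s∈map)
... | inj₂ s∈xs  = inj₂ s∈xs

∈-subseqs-++⁻ : ∀ xs {ys s : List ℕ} → s ∈ subseqs (xs ++ ys) →
  ∃₂ λ s₁ s₂ → s₁ ∈ subseqs xs × s₂ ∈ subseqs ys × s ≡ s₁ ++ s₂
∈-subseqs-++⁻ [] s∈ = [] , _ , here refl , s∈ , refl
∈-subseqs-++⁻ (x ∷ xs) {ys} s∈ with ∈-subseqs-∷⁻ x (xs ++ ys) s∈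
... | inj₁ (s′ , s′∈ , refl) =
  let s₁ , s₂ , s₁∈ , s₂∈ , eq = ∈-subseqs-++⁻ xs s′∈
  in x ∷ s₁ , s₂ , ∈-++⁺ˡ (∈-map⁺ (x ∷_) s₁∈) , s₂∈ , cong (x ∷_) eq
... | inj₂ s∈′ =
  let s₁ , s₂ , s₁∈ , s₂∈ , eq = ∈-subseqs-++⁻ xs s∈′
  in s₁ , s₂ , ∈-++⁺ʳ _ s₁∈ , s₂∈ , eq

∈-subseqs-length : ∀ xs {s : List ℕ} → s ∈ subseqs xs → length s ≤ length xs
∈-subseqs-length [] (here refl) = z≤n
∈-subseqs-length (x ∷ xs) s∈ with ∈-subseqs-∷⁻ x xs s∈
... | inj₁ (_ , s′∈ , refl) = s≤s (∈-subseqs-length xs s′∈)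
... | inj₂ s∈′              = m≤n⇒m≤1+n (∈-subseqs-length xs s∈′)

∈-subseqs-All : ∀ {P : ℕ → Set} {xs s} → All P xs → s ∈ subseqs xs → All P s
∈-subseqs-All [] (here refl) = []
∈-subseqs-All {xs = x ∷ xs} (px ∷ pxs) s∈ with ∈-subseqs-∷⁻ x xs s∈
... | inj₁ (_ , s′∈ , refl) = px ∷ ∈-subseqs-All pxs s′∈
... | inj₂ s∈′              = ∈-subseqs-All pxs s∈′

∈-subseqs-AllPairs : ∀ {R : ℕ → ℕ → Set} {xs s} → AllPairs R xs → s ∈ subseqs xs → AllPairs R s
∈-subseqs-AllPairs [] (here refl) = []
∈-subseqs-AllPairs {xs = x ∷ xs} (rx ∷ rxs) s∈ with ∈-subseqs-∷⁻ x xs s∈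
... | inj₁ (_ , s′∈ , refl) = ∈-subseqs-All rx s′∈ ∷ ∈-subseqs-AllPairs rxs s′∈
... | inj₂ s∈′              = ∈-subseqs-AllPairs rxs s∈′

eqList-sound : ∀ w p → T (eqList w p) → w ≡ p
eqList-sound []       []       _ = refl
eqList-sound (x ∷ xs) (y ∷ ys) t =
  let tx , txs = to T-∧ t in cong₂ _∷_ (≡ᵇ⇒≡ x y tx) (eqList-sound xs ys txs)

avoidsᵇ-true : ∀ e p → (∀ {s} → s ∈ subseqs e → reduce s ≢ p) → avoidsᵇ e p ≡ true
avoidsᵇ-true e p no-occurrence = sym (¬-not λ true≡any →
  let s , s∈ , matches = find (any⁻ _ (subseqs e) (subst T true≡any tt))
  in no-occurrence s∈ (eqList-sound (reduce s) p matches))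

reduce-rank≢0 : ∀ {a b} w → a ∈ w → a < b → length (filter (_<? b) (deduplicate _≟_ w)) ≢ 0
reduce-rank≢0 w a∈w a<b = from (length-filter≢0⇔∃ _ _) (_ , ∈-deduplicate⁺ _≟_ a∈w , a<b)

reduce≡0012⇒ : ∀ s → reduce s ≡ p0012 → ∃[ a ] ∃[ c ] ∃[ d ] s ≡ a ∷ a ∷ c ∷ d ∷ []
reduce≡0012⇒ s@(a ∷ b ∷ c ∷ d ∷ []) eq with <-cmp a b
... | tri< a<b _ _ =
  contradiction (∷-injectiveˡ (∷-injectiveʳ eq)) (reduce-rank≢0 s (here refl) a<b)
... | tri≈ _ refl _ = a , c , d , refl
... | tri> _ _ b<a = contradiction (∷-injectiveˡ eq) (reduce-rank≢0 s (there (here refl)) b<a)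

aacd≡increasing++⇒long : ∀ {a c d} s₁ {s₂} → a ∷ a ∷ c ∷ d ∷ [] ≡ s₁ ++ s₂ → AllPairs _<_ s₁ →
  2 < length s₂
aacd≡increasing++⇒long []           refl _ = s≤s (s≤s (s≤s z≤n))
aacd≡increasing++⇒long (_ ∷ [])     refl _ = s≤s (s≤s (s≤s z≤n))
aacd≡increasing++⇒long (_ ∷ _ ∷ _) eq ((x<y ∷ _) ∷ _) =
  contradiction x<y (<-irrefl (trans (sym (∷-injectiveˡ eq)) (∷-injectiveˡ (∷-injectiveʳ eq))))

increasing++short-avoids0012 : ∀ {xs ys} → AllPairs _<_ xs → length ys ≤ 2 →
  avoidsᵇ (xs ++ ys) p0012 ≡ true
increasing++short-avoids0012 {xs} {ys} xs↑ |ys|≤2 = avoidsᵇ-true (xs ++ ys) p0012 no-occurrence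
  where
  no-occurrence : ∀ {s} → s ∈ subseqs (xs ++ ys) → reduce s ≢ p0012
  no-occurrence s∈ reduced with reduce≡0012⇒ _ reduced | ∈-subseqs-++⁻ xs s∈
  ... | _ , _ , _ , refl | s₁ , _ , s₁∈ , s₂∈ , eq =
    <⇒≱ (aacd≡increasing++⇒long s₁ eq (∈-subseqs-AllPairs xs↑ s₁∈))
        (≤-trans (∈-subseqs-length ys s₂∈) |ys|≤2)

srpt-upTo++ : ∀ {j a} ys → a < j → All (a ≤_) ys → srpt (upTo j ++ a ∷ ys) ≡ a
srpt-upTo++ {j} {a} ys a<j a≤ys =
  srpt≡least-repeat (upTo j ++ a ∷ ys)
    (∈-both⇒occ≥2 (upTo j) (a ∷ ys) (∈-upTo⁺ a<j) (here refl)) minimal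
  where
  minimal : ∀ {y} → 2 ≤ occ y (upTo j ++ a ∷ ys) → a ≤ y
  minimal occ≥2 with repeated-in-suffix (upTo-increasing j) occ≥2
  ... | here refl  = ≤-refl
  ... | there y∈ys = All.lookup a≤ys y∈ys

identity-realised : ∀ m → ∃ (Realises (suc m) (+ m) (+ m))
identity-realised m =
  upTo m ∷ʳ m , ∷ʳ∈invSeqs (upTo∈invSeqs m) ≤-refl ,
  increasing++short-avoids0012 (upTo-increasing m) (s≤s z≤n) ,
  cong +_ (srpt-upTo m) , cong +_ (lastEntry-++ (upTo m))

diagonal-realised : ∀ {m a} → a < m → ∃ (Realises (suc m) (+ a) (+ a))
diagonal-realised {m} {a} a<m =
  upTo m ∷ʳ a , ∷ʳ∈invSeqs (upTo∈invSeqs m) (<⇒≤ a<m) ,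
  increasing++short-avoids0012 (upTo-increasing m) (s≤s z≤n) ,
  cong +_ (srpt-upTo++ [] a<m []) , cong +_ (lastEntry-++ (upTo m))

offDiagonal-realised : ∀ {j a b} → a < j → a < b → b ≤ suc j →
  ∃ (Realises (suc (suc j)) (+ a) (+ b))
offDiagonal-realised {j} {a} {b} a<j a<b b≤1+j =
  upTo j ++ a ∷ b ∷ [] ,
  subst (_∈ invSeqs (suc (suc j))) (++-assoc (upTo j) [ a ] [ b ])
    (∷ʳ∈invSeqs (∷ʳ∈invSeqs (upTo∈invSeqs j) (<⇒≤ a<j)) b≤1+j) ,
  increasing++short-avoids0012 (upTo-increasing j) ≤-refl ,
  cong +_ (srpt-upTo++ [ b ] a<j (<⇒≤ a<b ∷ [])) , cong +_ (lastEntry-++ (upTo j))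

admissible⇒realised : ∀ {m a b} → Admissible m a b → ∃ (Realises (suc m) (+ a) (+ b))
admissible⇒realised (admissible a≤b b≤m not-corner) with m≤n⇒m<n∨m≡n a≤b
... | inj₂ refl with m≤n⇒m<n∨m≡n b≤m
...   | inj₁ a<m  = diagonal-realised a<m
...   | inj₂ refl = identity-realised _
admissible⇒realised (admissible a≤b b≤m not-corner) | inj₁ a<b
  with m≤n⇒m<n∨m≡n (≤-trans a<b b≤m)
... | inj₁ (s≤s a<j) = offDiagonal-realised a<j a<b b≤m
... | inj₂ 1+a≡m     = contradiction (1+a≡m , ≤-antisym b≤m (subst (_≤ _) 1+a≡m a<b)) not-corner

Region : ℕ → ℤ → ℤ → Set
Region n k ℓ = (+ 0 Data.Integer.≤ k) × (k Data.Integer.≤ ℓ) × (ℓ Data.Integer.≤ + n - + 1)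
  × ¬ ((k ≡ + n - + 2) × (ℓ ≡ + n - + 1))

admissible⇒region : ∀ {m a b} → Admissible m a b → Region (suc m) (+ a) (+ b)
admissible⇒region {zero} (admissible a≤b b≤m _) =
  +≤+ z≤n , +≤+ a≤b , +≤+ b≤m , λ { (() , _) }
admissible⇒region {suc m} (admissible a≤b b≤m not-corner) =
  +≤+ z≤n , +≤+ a≤b , +≤+ b≤m , λ { (refl , refl) → not-corner (refl , refl) }

region⇒admissible : ∀ {m k ℓ} → Region (suc m) k ℓ → ∃₂ λ a b → k ≡ + a × ℓ ≡ + b × Admissible m a b
region⇒admissible {k = + a} {ℓ = + b} (_ , +≤+ a≤b , +≤+ b≤m , not-corner) =
  a , b , refl , refl , admissible a≤b b≤m λ { (refl , refl) → not-corner (refl , refl) }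

corollary3p2 : (n : ℕ) → 1 ≤ n → (k ℓ : ℤ) →
    (f n k ℓ ≢ 0 ⇔
      ((+ 0 Data.Integer.≤ k) × (k Data.Integer.≤ ℓ) × (ℓ Data.Integer.≤ + n - + 1)
        × ¬ ((k ≡ + n - + 2) × (ℓ ≡ + n - + 1))))
corollary3p2 (suc m) (s≤s z≤n) k ℓ = mk⇔ necessary sufficient
  where
  necessary : f (suc m) k ℓ ≢ 0 → Region (suc m) k ℓ
  necessary f≢0 with to (f≢0⇔realised (suc m) k ℓ) f≢0
  ... | e , e∈ , _ , refl , refl = admissible⇒region (admissible-srpt-last e∈)
  sufficient : Region (suc m) k ℓ → f (suc m) k ℓ ≢ 0
  sufficient region with region⇒admissible region
  ... | a , b , refl , refl , adm =
    from (f≢0⇔realised (suc m) (+ a) (+ b)) (admissible⇒realised adm)
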